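{- Let $\mathcal{K}=(\Sigma,\to,\ell)$ be a Kripke structure over $AP$ and $R\in\mathrm{PreOrd}(\Sigma)$. Then $R$ is a simulation on $\mathcal{K}$ if and only if $\mathrm{dis}(R)$ is forward complete for $\{\boldsymbol{p}\mid p\in AP\}\cup\{\widetilde{\mathrm{pre}}_{\to}\}$.
   Context: $\to\subseteq\Sigma\times\Sigma$ is total; $\ell:\Sigma\to\wp(AP)$; $\boldsymbol{p}=\{s\mid p\in\ell(s)\}$; $\widetilde{\mathrm{pre}}_{\to}(Y)=\{a\in\Sigma\mid\forall b.\,(a\to b\Rightarrow b\in Y)\}$. $\mathrm{PreOrd}(\Sigma)$ is the set of preorders on $\Sigma$. A relation $R$ is a simulation if whenever $sRs'$: $\ell(s')\subseteq\ell(s)$, and for every $t$ with $s\to t$ there is $t'$ with $s'\to t'$ and $tRt'$. For a preorder $R$, $\mathrm{dis}(R)$ is the abstract domain of $\wp(\Sigma)_\subseteq$ whose associated closure is $\mathrm{pre}_R(S)=\{x\mid\exists y\in S.\,xRy\}$. A closure $\mu$ is forward complete for a constant set $X$ if $\mu(X)=X$, and for a unary $f$ if $f\circ\mu=\mu\circ f\circ\mu$. -}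

module Defs where

open import Level using (0ℓ)
open import Data.Product using (Σ; ∃; _×_; _,_)
open import Relation.Unary using (Pred; _⊆_; _≐_; _∈_)
open import Relation.Binary.Core using (Rel)
open import Relation.Binary.PropositionalEquality using (_≡_)
open import Relation.Binary.Structures using (IsPreorder)

record Kripke (AP : Set) : Set₁ where
  field
    State : Set
    _⟶_   : Rel State 0ℓ
    total : ∀ s → ∃ λ t → s ⟶ t
    ℓ     : State → Pred AP 0ℓ

module _ {AP : Set} (K : Kripke AP) where
  open Kripke K

  IsPreOrd : Rel State 0ℓ → Set
  IsPreOrd R = IsPreorder _≡_ R

  ⟦_⟧ : AP → Pred State 0ℓ
  ⟦ p ⟧ s = p ∈ ℓ s

  preU : Pred State 0ℓ → Pred State 0ℓ
  preU Y a = ∀ b → a ⟶ b → b ∈ Y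

  IsSimulation : Rel State 0ℓ → Set
  IsSimulation R = ∀ s s' → R s s' →
      (ℓ s' ⊆ ℓ s)
    × (∀ t → s ⟶ t → ∃ λ t' → (s' ⟶ t') × R t t')

-- pre_R(S) = { x | ∃ y ∈ S. x R y }: the closure associated with dis(R)
preR : {A : Set} → Rel A 0ℓ → Pred A 0ℓ → Pred A 0ℓ
preR R S x = ∃ λ y → (y ∈ S) × R x y

FwdCompleteConst : {A : Set} → (Pred A 0ℓ → Pred A 0ℓ) → Pred A 0ℓ → Set
FwdCompleteConst μ X = μ X ≐ X

FwdCompleteFun : {A : Set} → (Pred A 0ℓ → Pred A 0ℓ) → (Pred A 0ℓ → Pred A 0ℓ) → Set₁
FwdCompleteFun μ f = ∀ Y → f (μ Y) ≐ μ (f (μ Y))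

DisFwdComplete : {AP : Set} (K : Kripke AP) → Rel (Kripke.State K) 0ℓ → Set₁
DisFwdComplete K R =
    (∀ p → FwdCompleteConst (preR R) (⟦_⟧ K p))
  × FwdCompleteFun (preR R) (preU K)

{-# OPTIONS --safe #-}
module Submission where

open import Defs
open import Level using (0ℓ)
open import Relation.Binary.Core using (Rel)
open import Function.Bundles using (_⇔_; mk⇔; module Equivalence)
open import Function.Construct.Composition using (_⇔-∘_)
open import Data.Product using (∃; _×_; _,_; proj₁; proj₂)
open import Data.Product.Function.NonDependent.Propositional using (_×-⇔_)
open import Relation.Unary using (Pred; _⊆_; _∈_)
open import Relation.Unary.Properties using (≐-sym)
open import Relation.Binary.Definitions using (Reflexive)
open import Relation.Binary.Structures using (IsPreorder)

-- For reflexive R, the sets fixed by pre_R are exactly the R-down-sets, so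
-- forward completeness says that each ⟦p⟧ is a down-set (the label condition)
-- and that pre~ maps down-sets to down-sets.  For a preorder the latter is the
-- transfer condition: one direction is transitivity, the other instantiates it
-- at the down-set generated by the successors of s'.

DownSet : {A : Set} → Rel A 0ℓ → Pred A 0ℓ → Set
DownSet R X = ∀ {x y} → R x y → y ∈ X → x ∈ X

module _ {A : Set} {R : Rel A 0ℓ} where

  downSet⇒preR-⊆ : {X : Pred A 0ℓ} → DownSet R X → preR R X ⊆ X
  downSet⇒preR-⊆ down (_ , y∈X , xRy) = down xRy y∈X

  preR-⊆⇒downSet : {X : Pred A 0ℓ} → preR R X ⊆ X → DownSet R X
  preR-⊆⇒downSet preR⊆X xRy y∈X = preR⊆X (_ , y∈X , xRy)

  ⊆-preR : Reflexive R → {X : Pred A 0ℓ} → X ⊆ preR R X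
  ⊆-preR refl {x = x} x∈X = x , x∈X , refl

  downSet⇔fwdCompleteConst-preR : Reflexive R → {X : Pred A 0ℓ} →
    DownSet R X ⇔ FwdCompleteConst (preR R) X
  downSet⇔fwdCompleteConst-preR refl {X} = mk⇔ to from
    where
    to : DownSet R X → FwdCompleteConst (preR R) X
    to down = downSet⇒preR-⊆ down , ⊆-preR refl

    from : FwdCompleteConst (preR R) X → DownSet R X
    from (preR⊆X , _) = preR-⊆⇒downSet preR⊆X

  downSets⇔fwdCompleteFun-preR : Reflexive R → (f : Pred A 0ℓ → Pred A 0ℓ) →
    (∀ Y → DownSet R (f (preR R Y))) ⇔ FwdCompleteFun (preR R) f
  downSets⇔fwdCompleteFun-preR refl f = mk⇔ to from
    where
    fixed : ∀ Y → DownSet R (f (preR R Y)) ⇔ FwdCompleteConst (preR R) (f (preR R Y))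
    fixed Y = downSet⇔fwdCompleteConst-preR refl

    to : (∀ Y → DownSet R (f (preR R Y))) → FwdCompleteFun (preR R) f
    to down Y = ≐-sym (Equivalence.to (fixed Y) (down Y))

    from : FwdCompleteFun (preR R) f → ∀ Y → DownSet R (f (preR R Y))
    from complete Y = Equivalence.from (fixed Y) (≐-sym (complete Y))

module _ {AP : Set} (K : Kripke AP) (R : Rel (Kripke.State K) 0ℓ) where
  open Kripke K

  LabelsReflected : Set
  LabelsReflected = ∀ s s' → R s s' → ℓ s' ⊆ ℓ s

  TransitionsSimulated : Set
  TransitionsSimulated =
    ∀ s s' → R s s' → ∀ t → s ⟶ t → ∃ λ t' → (s' ⟶ t') × R t t'

  isSimulation⇔labels×transitions :
    IsSimulation K R ⇔ (LabelsReflected × TransitionsSimulated)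
  isSimulation⇔labels×transitions = mk⇔
    (λ sim → (λ s s' sRs' → proj₁ (sim s s' sRs'))
           , (λ s s' sRs' → proj₂ (sim s s' sRs')))
    (λ (labels , transitions) s s' sRs' → labels s s' sRs' , transitions s s' sRs')

  labelsReflected⇔atomsFwdComplete : Reflexive R →
    LabelsReflected ⇔ (∀ p → FwdCompleteConst (preR R) (⟦_⟧ K p))
  labelsReflected⇔atomsFwdComplete refl = mk⇔
    (λ labels p → Equivalence.to (downSet⇔fwdCompleteConst-preR refl)
                    (λ {s} {s'} sRs' → labels s s' sRs'))
    (λ complete s s' sRs' {p} →
       Equivalence.from (downSet⇔fwdCompleteConst-preR refl) (complete p) sRs')

  module _ (isPreOrd : IsPreOrd K R) where
    open IsPreorder isPreOrd using (refl; trans)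

    transitionsSimulated⇔preU-downSets :
      TransitionsSimulated ⇔ (∀ Y → DownSet R (preU K (preR R Y)))
    transitionsSimulated⇔preU-downSets = mk⇔ preserves reflects
      where
      preserves : TransitionsSimulated → ∀ Y → DownSet R (preU K (preR R Y))
      preserves transitions Y {s} {s'} sRs' s'∈ t s⟶t
        with t' , s'⟶t' , tRt' ← transitions s s' sRs' t s⟶t
        with u , u∈Y , t'Ru ← s'∈ t' s'⟶t'
        = u , u∈Y , trans tRt' t'Ru

      reflects : (∀ Y → DownSet R (preU K (preR R Y))) → TransitionsSimulated
      reflects down s s' sRs' = down (s' ⟶_) sRs' (λ _ → ⊆-preR {R = R} refl)

    transitionsSimulated⇔preUFwdComplete :
      TransitionsSimulated ⇔ FwdCompleteFun (preR R) (preU K)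
    transitionsSimulated⇔preUFwdComplete =
      downSets⇔fwdCompleteFun-preR refl (preU K)
        ⇔-∘ transitionsSimulated⇔preU-downSets

theorem7p8 : {AP : Set} (K : Kripke AP) (R : Rel (Kripke.State K) 0ℓ) →
    IsPreOrd K R → (IsSimulation K R ⇔ DisFwdComplete K R)
theorem7p8 K R isPreOrd =
  (labelsReflected⇔atomsFwdComplete K R (IsPreorder.refl isPreOrd)
     ×-⇔ transitionsSimulated⇔preUFwdComplete K R isPreOrd)
  ⇔-∘ isSimulation⇔labels×transitions K R
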